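{- $\operatorname{Det}(\mathrm{PX}(4,3))=2=\lceil 4/3\rceil$.
   Context: For integers $n\ge 3$ and $1\le k<n$, the Praeger–Xu graph $\mathrm{PX}(n,k)$ is the simple graph with vertex set $\mathbb Z_n\times\mathbb Z_2^k$; a vertex is written $(i,x)$ with $x=x_0x_1\cdots x_{k-1}$ a bitstring of length $k$. Two vertices $(i,x)$ and $(j,y)$ are adjacent if and only if (after possibly swapping the two vertices) $j=i+1$ in $\mathbb Z_n$ and $x=az_1\cdots z_{k-1}$, $y=z_1\cdots z_{k-1}b$ for some bits $a,b,z_1,\dots,z_{k-1}\in\mathbb Z_2$. For a graph $G$, $\operatorname{Det}(G)$ is the minimum size of a set $S$ of vertices such that the only automorphism of $G$ fixing every vertex of $S$ is the identity. -}

module Defs where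

open import Data.Nat using (ℕ; zero; suc; _+_; _∸_; _≤_; NonZero)
open import Data.Nat.DivMod using (_mod_; _/_)
open import Data.Fin using (Fin; toℕ)
open import Data.Bool using (Bool)
open import Data.Vec using (Vec; _∷_; _∷ʳ_)
open import Data.Product using (_×_; _,_; Σ; ∃; ∃-syntax)
open import Data.Sum using (_⊎_)
open import Data.List using (List; length)
open import Data.List.Relation.Unary.All using (All)
open import Data.List.Relation.Unary.Unique.Propositional using (Unique)
open import Relation.Binary.PropositionalEquality using (_≡_)

ceilDiv : (m n : ℕ) .{{_ : NonZero n}} → ℕ
ceilDiv m n = (m + n ∸ 1) / n

sucMod : (n : ℕ) .{{_ : NonZero n}} → Fin n → Fin n
sucMod n i = (toℕ i + 1) mod n

record Automorphism (V : Set) (Adj : V → V → Set) : Set where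
  field
    fun      : V → V
    inv      : V → V
    inv-left  : ∀ v → inv (fun v) ≡ v
    inv-right : ∀ v → fun (inv v) ≡ v
    preserves : ∀ u v → Adj u v → Adj (fun u) (fun v)
    reflects  : ∀ u v → Adj (fun u) (fun v) → Adj u v

IsDetermining : (V : Set) (Adj : V → V → Set) → List V → Set
IsDetermining V Adj S =
  (φ : Automorphism V Adj) →
  All (λ s → Automorphism.fun φ s ≡ s) S →
  ∀ v → Automorphism.fun φ v ≡ v

DetIs : (V : Set) (Adj : V → V → Set) → ℕ → Set
DetIs V Adj d =
  (Σ (List V) λ S → Unique S × length S ≡ d × IsDetermining V Adj S)
  × ((S : List V) → Unique S → IsDetermining V Adj S → d ≤ length S)

PXVertex : ℕ → ℕ → Set
PXVertex n k = Fin n × Vec Bool k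

-- directed "step" from (i, a z) to (i+1, z b); defined for k = suc m ≥ 1
PXStep : (n m : ℕ) .{{_ : NonZero n}} →
         PXVertex n (suc m) → PXVertex n (suc m) → Set
PXStep n m (i , x) (j , y) =
  j ≡ sucMod n i ×
  ∃[ a ] ∃[ b ] ∃[ z ] (x ≡ a ∷ z × y ≡ z ∷ʳ b)

PXAdj : (n m : ℕ) .{{_ : NonZero n}} →
        PXVertex n (suc m) → PXVertex n (suc m) → Set
PXAdj n m u v = PXStep n m u v ⊎ PXStep n m v u

-- For p ∈ ℤ₄, complementing in every vertex the bit that sits at position p of
-- the cycle (bit t of the word at layer i sits at i + t) maps steps to steps,
-- so it is an involutive automorphism. It moves (p , 000) but fixes the whole
-- layer p + 1, whose window {p + 1, p + 2, p + 3} misses p; hence no set of at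
-- most one vertex is determining. Conversely, assigning images vertex by vertex
-- in breadth-first order from (0 , 000) and (1 , 010), always keeping adjacency
-- and equality with the vertices already placed, leaves only the identity; this
-- finite search is decided by evaluation.

module Submission where

open import Defs
open import Data.Nat using (ℕ; zero; suc; s≤s; z≤n; _≤_; NonZero)
open import Data.Product using (_×_; _,_; proj₂; Σ; ∃; uncurry)
open import Data.Product.Properties as Product using ()
open import Data.Fin using (Fin; zero; suc; #_)
open import Data.Fin.Properties as Fin using ()
open import Data.Bool using (Bool; true; false; _xor_)
open import Data.Bool.Properties as Bool using (xor-assoc; xor-same; not-¬)
open import Data.Vec using (Vec; []; _∷_; _∷ʳ_; head; tail; init; last; initLast)
open import Data.Vec.Properties as Vec using (init-∷ʳ)
open import Data.Sum using (inj₁; inj₂)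
open import Data.List using (List; []; _∷_; length; map; cartesianProduct; cartesianProductWith; allFin)
open import Data.List.Relation.Unary.All using (All; []; _∷_; lookup; all?)
open import Data.List.Relation.Unary.All.Properties using (map⁺)
open import Data.List.Relation.Unary.AllPairs using ([]; _∷_)
open import Data.List.Relation.Unary.Any using (here; there)
open import Data.List.Membership.Propositional using (_∈_)
open import Data.List.Membership.Propositional.Properties
  using (∈-allFin; ∈-cartesianProduct⁺; ∈-cartesianProductWith⁺)
open import Data.List.Membership.DecPropositional as DecMembership using ()
open import Function using (_⇔_; mk⇔; Equivalence)
open import Relation.Binary.Definitions using (DecidableEquality; Decidable)
open import Relation.Binary.PropositionalEquality using (_≡_; _≢_; refl; sym; trans; cong; cong₂; subst₂)
open import Relation.Nullary using (Dec; yes; no; does; contradiction)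
open import Relation.Nullary.Decidable as Dec using (_×-dec_; _⊎-dec_; _→-dec_; from-yes)

open Automorphism

module _ {V : Set} {Adj : V → V → Set} where

  mkInvolutiveAutomorphism : (g : V → V) → (∀ v → g (g v) ≡ v) →
                             (∀ u v → Adj u v → Adj (g u) (g v)) → Automorphism V Adj
  mkInvolutiveAutomorphism g involutive preserves′ = record
    { fun = g ; inv = g ; inv-left = involutive ; inv-right = involutive
    ; preserves = preserves′
    ; reflects = λ u v a → subst₂ Adj (involutive u) (involutive v) (preserves′ (g u) (g v) a) }

  fun-injective : (φ : Automorphism V Adj) → ∀ {u v} → fun φ u ≡ fun φ v → u ≡ v
  fun-injective φ {u} {v} e = trans (sym (inv-left φ u)) (trans (cong (inv φ) e) (inv-left φ v))

  StabilisersNontrivial : Set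
  StabilisersNontrivial =
    ∀ s → Σ (Automorphism V Adj) λ φ → fun φ s ≡ s × ∃ λ w → fun φ w ≢ w

  determining⇒2≤length : V → StabilisersNontrivial →
                          ∀ S → IsDetermining V Adj S → 2 ≤ length S
  determining⇒2≤length v₀ stab [] det with stab v₀
  ... | φ , _ , w , moved = contradiction (det φ [] w) moved
  determining⇒2≤length v₀ stab (s ∷ []) det with stab s
  ... | φ , fixed , w , moved = contradiction (det φ (fixed ∷ []) w) moved
  determining⇒2≤length _ _ (_ ∷ _ ∷ _) _ = s≤s (s≤s z≤n)

_⇔-dec_ : ∀ {A B : Set} → Dec A → Dec B → Dec (A ⇔ B)
a? ⇔-dec b? = Dec.map′ (uncurry mk⇔) (λ e → Equivalence.to e , Equivalence.from e)
                        ((a? →-dec b?) ×-dec (b? →-dec a?))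

module RigiditySearch {V : Set} {Adj : V → V → Set}
                      (_≟_ : DecidableEquality V) (adj? : Decidable Adj)
                      (vertices : List V) (∈-vertices : ∀ v → v ∈ vertices) where

  Correspondence : Set
  Correspondence = List (V × V)

  Compatible : V → V → Correspondence → Set
  Compatible v c = All λ (u , d) → (Adj v u ⇔ Adj c d) × (v ≡ u ⇔ c ≡ d)

  Respects : Automorphism V Adj → Correspondence → Set
  Respects φ = All λ (u , d) → fun φ u ≡ d

  Rigid : Correspondence → List V → Set
  Rigid m []       = All (λ w → (w , w) ∈ m) vertices
  Rigid m (v ∷ vs) = All (λ c → Compatible v c m → Rigid ((v , c) ∷ m) vs) vertices

  rigid? : ∀ m vs → Dec (Rigid m vs)
  rigid? m []       = all? (λ w → (w , w) ∈? m) vertices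
    where open DecMembership (Product.≡-dec _≟_ _≟_) using (_∈?_)
  rigid? m (v ∷ vs) = all? (λ c → compatible? c m →-dec rigid? ((v , c) ∷ m) vs) vertices
    where
    compatible? : ∀ c m → Dec (Compatible v c m)
    compatible? c = all? λ (u , d) → (adj? v u ⇔-dec adj? c d) ×-dec ((v ≟ u) ⇔-dec (c ≟ d))

  module _ (φ : Automorphism V Adj) where

    respects⇒compatible : ∀ {m} v → Respects φ m → Compatible v (fun φ v) m
    respects⇒compatible v []            = []
    respects⇒compatible v (refl ∷ resp) =
      (mk⇔ (preserves φ v _) (reflects φ v _) , mk⇔ (cong (fun φ)) (fun-injective φ))
      ∷ respects⇒compatible v resp

    rigid⇒identity : ∀ {m} vs → Respects φ m → Rigid m vs → ∀ w → fun φ w ≡ w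
    rigid⇒identity []       resp rigid w = lookup resp (lookup rigid (∈-vertices w))
    rigid⇒identity (v ∷ vs) resp rigid   =
      rigid⇒identity vs (refl ∷ resp)
        (lookup rigid (∈-vertices (fun φ v)) (respects⇒compatible v resp))

  rigid⇒determining : ∀ S vs → Rigid (map (λ s → s , s) S) vs → IsDetermining V Adj S
  rigid⇒determining S vs rigid φ fixed = rigid⇒identity φ vs (map⁺ fixed) rigid

module _ {n m : ℕ} .{{_ : NonZero n}} where

  pxStep⇔ : ∀ {i j : Fin n} {x y : Vec Bool (suc m)} →
            PXStep n m (i , x) (j , y) ⇔ (j ≡ sucMod n i × tail x ≡ init y)
  pxStep⇔ {i} {j} {a ∷ z} {y} = mk⇔ to from
    where
    to : PXStep n m (i , a ∷ z) (j , y) → j ≡ sucMod n i × z ≡ init y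
    to (j≡i+1 , _ , b , _ , refl , refl) = j≡i+1 , sym (init-∷ʳ b z)
    from : j ≡ sucMod n i × z ≡ init y → PXStep n m (i , a ∷ z) (j , y)
    from (j≡i+1 , z≡init) = j≡i+1 , a , last y , z , refl ,
      trans (proj₂ (proj₂ (initLast y))) (cong (_∷ʳ last y) (sym z≡init))

  pxStep? : Decidable (PXStep n m)
  pxStep? (i , x) (j , y) =
    Dec.map′ (Equivalence.from pxStep⇔) (Equivalence.to pxStep⇔)
      ((j Fin.≟ sucMod n i) ×-dec Vec.≡-dec Bool._≟_ (tail x) (init y))

  pxAdj? : Decidable (PXAdj n m)
  pxAdj? u v = pxStep? u v ⊎-dec pxStep? v u

module _ {n : ℕ} .{{_ : NonZero n}} (p : Fin n) where

  flipFrom : ∀ {k} → Fin n → Vec Bool k → Vec Bool k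
  flipFrom j []      = []
  flipFrom j (b ∷ x) = (does (p Fin.≟ j) xor b) ∷ flipFrom (sucMod n j) x

  flipAt : ∀ {k} → PXVertex n k → PXVertex n k
  flipAt (i , x) = i , flipFrom i x

  flipFrom-involutive : ∀ {k} j (x : Vec Bool k) → flipFrom j (flipFrom j x) ≡ x
  flipFrom-involutive j []      = refl
  flipFrom-involutive j (b ∷ x) =
    cong₂ _∷_ (trans (sym (xor-assoc c c b)) (cong (_xor b) (xor-same c)))
              (flipFrom-involutive (sucMod n j) x)
    where c = does (p Fin.≟ j)

  flipFrom-∷ʳ : ∀ {k} j (z : Vec Bool k) b → ∃ λ b′ → flipFrom j (z ∷ʳ b) ≡ flipFrom j z ∷ʳ b′
  flipFrom-∷ʳ j []      b = does (p Fin.≟ j) xor b , refl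
  flipFrom-∷ʳ j (a ∷ z) b with flipFrom-∷ʳ (sucMod n j) z b
  ... | b′ , eq = b′ , cong (_ ∷_) eq

  flipAt-step : ∀ {m} {u v : PXVertex n (suc m)} →
                PXStep n m u v → PXStep n m (flipAt u) (flipAt v)
  flipAt-step {u = i , _} (refl , a , b , z , refl , refl)
    with b′ , eq ← flipFrom-∷ʳ (sucMod n i) z b =
    refl , _ , b′ , flipFrom (sucMod n i) z , refl , eq

  flipAutomorphism : ∀ {m} → Automorphism (PXVertex n (suc m)) (PXAdj n m)
  flipAutomorphism = mkInvolutiveAutomorphism flipAt
    (λ (i , x) → cong (i ,_) (flipFrom-involutive i x))
    (λ where _ _ (inj₁ s) → inj₁ (flipAt-step s)
             _ _ (inj₂ s) → inj₂ (flipAt-step s))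

  flipAt-moves : ∀ {m} (x : Vec Bool (suc m)) → flipAt (p , x) ≢ (p , x)
  flipAt-moves (b ∷ _) eq with p Fin.≟ p
  ... | yes _  = not-¬ refl (sym (cong (λ (_ , x) → head x) eq))
  ... | no p≢p = p≢p refl

words : ∀ {A : Set} → List A → (k : ℕ) → List (Vec A k)
words xs zero    = [] ∷ []
words xs (suc k) = cartesianProductWith _∷_ xs (words xs k)

∈-words : ∀ {A : Set} {xs : List A} → (∀ a → a ∈ xs) → ∀ {k} (w : Vec A k) → w ∈ words xs k
∈-words ∈-xs []      = here refl
∈-words ∈-xs (a ∷ w) = ∈-cartesianProductWith⁺ _∷_ (∈-xs a) (∈-words ∈-xs w)

∈-bools : ∀ b → b ∈ false ∷ true ∷ []
∈-bools false = here refl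
∈-bools true  = there (here refl)

pxVertices : ∀ n k → List (PXVertex n k)
pxVertices n k = cartesianProduct (allFin n) (words (false ∷ true ∷ []) k)

∈-pxVertices : ∀ {n k} (v : PXVertex n k) → v ∈ pxVertices n k
∈-pxVertices (i , x) = ∈-cartesianProduct⁺ (∈-allFin i) (∈-words ∈-bools x)

pxVertex-≟ : ∀ {n k} → DecidableEquality (PXVertex n k)
pxVertex-≟ = Product.≡-dec Fin._≟_ (Vec.≡-dec Bool._≟_)

predMod4 : Fin 4 → Fin 4
predMod4 zero                   = # 3
predMod4 (suc zero)             = # 0
predMod4 (suc (suc zero))       = # 1
predMod4 (suc (suc (suc zero))) = # 2

flipAt-pred-fixes : ∀ i (x : Vec Bool 3) → flipAt (predMod4 i) (i , x) ≡ (i , x)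
flipAt-pred-fixes zero                   (_ ∷ _ ∷ _ ∷ []) = refl
flipAt-pred-fixes (suc zero)             (_ ∷ _ ∷ _ ∷ []) = refl
flipAt-pred-fixes (suc (suc zero))       (_ ∷ _ ∷ _ ∷ []) = refl
flipAt-pred-fixes (suc (suc (suc zero))) (_ ∷ _ ∷ _ ∷ []) = refl

px-4-3-stabilisersNontrivial : StabilisersNontrivial {PXVertex 4 3} {PXAdj 4 2}
px-4-3-stabilisersNontrivial (i , x) =
  flipAutomorphism (predMod4 i) , flipAt-pred-fixes i x , (predMod4 i , x) , flipAt-moves (predMod4 i) x

O I : Bool
O = false
I = true

va vb : PXVertex 4 3
va = # 0 , O ∷ O ∷ O ∷ []
vb = # 1 , O ∷ I ∷ O ∷ []

-- Breadth-first from va and vb, so each vertex has few compatible images.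
searchOrder : List (PXVertex 4 3)
searchOrder =
  (# 0 , O ∷ O ∷ O ∷ []) ∷ (# 1 , O ∷ I ∷ O ∷ []) ∷ (# 0 , O ∷ O ∷ I ∷ []) ∷ (# 0 , I ∷ O ∷ I ∷ []) ∷
  (# 1 , O ∷ O ∷ O ∷ []) ∷ (# 1 , O ∷ O ∷ I ∷ []) ∷ (# 2 , I ∷ O ∷ O ∷ []) ∷ (# 2 , I ∷ O ∷ I ∷ []) ∷
  (# 3 , O ∷ O ∷ O ∷ []) ∷ (# 3 , I ∷ O ∷ O ∷ []) ∷ (# 0 , I ∷ O ∷ O ∷ []) ∷ (# 1 , O ∷ I ∷ I ∷ []) ∷
  (# 1 , I ∷ I ∷ O ∷ []) ∷ (# 2 , O ∷ O ∷ O ∷ []) ∷ (# 2 , O ∷ O ∷ I ∷ []) ∷ (# 2 , O ∷ I ∷ O ∷ []) ∷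
  (# 2 , O ∷ I ∷ I ∷ []) ∷ (# 2 , I ∷ I ∷ O ∷ []) ∷ (# 3 , O ∷ O ∷ I ∷ []) ∷ (# 3 , O ∷ I ∷ O ∷ []) ∷
  (# 3 , O ∷ I ∷ I ∷ []) ∷ (# 3 , I ∷ I ∷ O ∷ []) ∷ (# 0 , O ∷ I ∷ O ∷ []) ∷ (# 0 , O ∷ I ∷ I ∷ []) ∷
  (# 0 , I ∷ I ∷ O ∷ []) ∷ (# 0 , I ∷ I ∷ I ∷ []) ∷ (# 1 , I ∷ O ∷ O ∷ []) ∷ (# 1 , I ∷ O ∷ I ∷ []) ∷
  (# 1 , I ∷ I ∷ I ∷ []) ∷ (# 2 , I ∷ I ∷ I ∷ []) ∷ (# 3 , I ∷ O ∷ I ∷ []) ∷ (# 3 , I ∷ I ∷ I ∷ []) ∷ []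

va-vb-determining : IsDetermining (PXVertex 4 3) (PXAdj 4 2) (va ∷ vb ∷ [])
va-vb-determining = rigid⇒determining (va ∷ vb ∷ []) searchOrder
  (from-yes (rigid? (map (λ s → s , s) (va ∷ vb ∷ [])) searchOrder))
  where open RigiditySearch pxVertex-≟ pxAdj? (pxVertices 4 3) ∈-pxVertices

proposition4p4 : DetIs (PXVertex 4 3) (PXAdj 4 2) 2 × 2 ≡ ceilDiv 4 3
proposition4p4 =
  ( ((va ∷ vb ∷ []) , ((λ ()) ∷ []) ∷ [] ∷ [] , refl , va-vb-determining)
  , λ S _ → determining⇒2≤length va px-4-3-stabilisersNontrivial S )
  , refl
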